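{- Let $K$ be a positive commutative semiring, let $\mathcal G=(V,V_0,V_1,T,E)$ be a finite acyclic game graph, and let $f_0,f_1:V\to K$ be the $K$-valuations of the two players induced by basic valuations $f_\sigma:T\to K$ and $h_\sigma:E\to K\setminus\{0\}$ ($\sigma=0,1$). If $f_0,f_1$ are strongly separating on $T$, then they are strongly separating on all of $V$.
   Context: A game graph is $\mathcal G=(V,V_0,V_1,T,E)$ where $V$ is the disjoint union of $V_0$ (positions of Player 0), $V_1$ (positions of Player 1) and $T$ (terminal positions), $E\subseteq V\times V$, $vE=\{w:(v,w)\in E\}$, $vE=\emptyset$ iff $v\in T$. For each $\sigma$, $f_\sigma$ extends to $V$ by backward induction: $f_\sigma(v)=\sum_{w\in vE}h_\sigma(vw)f_\sigma(w)$ if $v\in V_\sigma$ and $f_\sigma(v)=\prod_{w\in vE}h_\sigma(vw)f_\sigma(w)$ if $v\in V_{1-\sigma}$. A semiring is positive if $a+b=0$ implies $a=b=0$ and $a\cdot b=0$ implies $a=0$ or $b=0$. $f_0,f_1$ are strongly separating on $U\subseteq V$ if for every $u\in U$ we have ($f_0(u)=0$ or $f_1(u)=0$) and $f_0(u)+f_1(u)\neq0$. -}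

module Defs where

open import Level using (Level; _⊔_)
open import Data.Nat using (ℕ)
open import Data.Fin using (Fin)
open import Data.Bool using (Bool; true; false; if_then_else_)
open import Data.Product using (_×_)
open import Data.Sum using (_⊎_)
open import Relation.Nullary using (¬_)
open import Relation.Binary.PropositionalEquality using (_≡_)
open import Relation.Binary.Construct.Closure.Transitive using (TransClosure)
open import Algebra.Bundles using (CommutativeSemiring)
import Algebra.Properties.Monoid.Sum as MonoidSum

data Player : Set where
  P0 P1 : Player

opp : Player → Player
opp P0 = P1
opp P1 = P0

data Kind : Set where
  owned : Player → Kind
  terminal : Kind

-- A finite game graph on the positions Fin n: V is the disjoint union of
-- V₀, V₁, T via `kind`; E is a decidable (Bool-valued) edge relation;
-- vE = ∅ iff v ∈ T.
record GameGraph (n : ℕ) : Set where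
  field
    kind : Fin n → Kind
    edge : Fin n → Fin n → Bool
    terminal-iff-noSucc : ∀ v → kind v ≡ terminal → ∀ w → edge v w ≡ false
    noSucc-iff-terminal : ∀ v → (∀ w → edge v w ≡ false) → kind v ≡ terminal

  E : Fin n → Fin n → Set
  E v w = edge v w ≡ true

Acyclic : ∀ {n} → GameGraph n → Set
Acyclic G = ∀ v → ¬ TransClosure (GameGraph.E G) v v

module _ {c ℓ : Level} (K : CommutativeSemiring c ℓ) where
  open CommutativeSemiring K

  Positive : Set (c ⊔ ℓ)
  Positive = (∀ a b → a + b ≈ 0# → (a ≈ 0#) × (b ≈ 0#))
           × (∀ a b → a * b ≈ 0# → (a ≈ 0#) ⊎ (b ≈ 0#))

  open MonoidSum +-monoid renaming (sum to Σ⁺)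
  open MonoidSum *-monoid renaming (sum to Π*)

  succSum : ∀ {n} → GameGraph n → (Fin n → Fin n → Carrier) → (Fin n → Carrier) → Fin n → Carrier
  succSum G h f v = Σ⁺ (λ w → if GameGraph.edge G v w then h v w * f w else 0#)

  succProd : ∀ {n} → GameGraph n → (Fin n → Fin n → Carrier) → (Fin n → Carrier) → Fin n → Carrier
  succProd G h f v = Π* (λ w → if GameGraph.edge G v w then h v w * f w else 1#)

  -- f : Player → V → K is the K-valuation induced (by backward induction) by the
  -- basic valuations f σ ↾ T and h σ : E → K: the backward-induction equations hold
  -- at every non-terminal position.
  IsInducedValuation : ∀ {n} → GameGraph n → (Player → Fin n → Fin n → Carrier)
                     → (Player → Fin n → Carrier) → Set ℓ
  IsInducedValuation G h f =
    ∀ σ v → (GameGraph.kind G v ≡ owned σ → f σ v ≈ succSum G (h σ) (f σ) v)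
          × (GameGraph.kind G v ≡ owned (opp σ) → f σ v ≈ succProd G (h σ) (f σ) v)

  NonzeroOnEdges : ∀ {n} → GameGraph n → (Player → Fin n → Fin n → Carrier) → Set ℓ
  NonzeroOnEdges G h = ∀ σ v w → GameGraph.E G v w → ¬ (h σ v w ≈ 0#)

  StronglySeparatingAt : ∀ {n} → (Player → Fin n → Carrier) → Fin n → Set ℓ
  StronglySeparatingAt f u = ((f P0 u ≈ 0#) ⊎ (f P1 u ≈ 0#)) × ¬ (f P0 u + f P1 u ≈ 0#)

-- Strong separation propagates from the leaves to a position v by backward induction.
-- At a position of Player 0, f₀ is a sum and f₁ a product over the successors, with
-- nonzero edge weights. Each successor has one value zero: if some successor has
-- f₁ = 0 the product vanishes, otherwise every f₀-term vanishes and so does the sum.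
-- If both f₀(v) and f₁(v) were zero, positivity would make every f₀-term and some
-- f₁-term zero, so after cancelling the weights one successor would have f₀ = f₁ = 0.
-- Acyclicity of the finite graph makes the backward induction well founded: a walk
-- with more steps than positions repeats a position and so closes a cycle.
module Submission where

open import Defs
open import Level using (Level)
open import Data.Nat using (ℕ)
open import Data.Fin using (Fin)
open import Relation.Binary.PropositionalEquality using (_≡_)
open import Algebra.Bundles using (CommutativeSemiring)

open import Data.Nat using (zero; suc; _<_; _≤_; s≤s)
open import Data.Nat.Properties using (m<1+n⇒m<n∨m≡n; <⇒≤; n<1+n)
open import Data.Fin using (toℕ)
open import Data.Fin.Properties using (pigeonhole; toℕ≤pred[n]; ¬∀⟶∃¬)
open import Data.Bool using (Bool; true; false; if_then_else_; _≟_)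
open import Data.Bool.Properties using (¬-not)
open import Data.Product using (_×_; _,_; proj₁; proj₂; ∃)
open import Data.Sum using (_⊎_; inj₁; inj₂; [_,_])
open import Data.Empty using (⊥-elim)
open import Function using (id; _∘_)
open import Relation.Nullary using (¬_; yes; no)
open import Relation.Unary using (Pred)
open import Relation.Binary using (Rel; Decidable)
import Relation.Binary.PropositionalEquality as ≡
open import Relation.Binary.Construct.Closure.Transitive using (TransClosure; _∷ʳ_)
  renaming ([_] to [_]⁺)
import Algebra.Properties.Monoid.Sum as MonoidSum

∀⊎⇒∃⊎∀ : ∀ {a b n} {A : Pred (Fin n) a} {B : Pred (Fin n) b}
       → (∀ w → A w ⊎ B w) → ∃ A ⊎ (∀ w → B w)
∀⊎⇒∃⊎∀ {n = zero} A⊎B = inj₂ λ ()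
∀⊎⇒∃⊎∀ {n = suc n} A⊎B with A⊎B Fin.zero | ∀⊎⇒∃⊎∀ (A⊎B ∘ Fin.suc)
... | inj₁ a | _ = inj₁ (Fin.zero , a)
... | inj₂ _ | inj₁ (w , a) = inj₁ (Fin.suc w , a)
... | inj₂ b | inj₂ bs = inj₂ λ { Fin.zero → b ; (Fin.suc w) → bs w }

module Walks {n r} (R : Rel (Fin n) r) where

  Walk : ℕ → Fin n → Set r
  Walk k v = ∃ λ (p : ℕ → Fin n) → p 0 ≡ v × (∀ i → i < k → R (p i) (p (suc i)))

  walk-cons : ∀ {k v w} → R v w → Walk k w → Walk (suc k) v
  walk-cons {k} {v} vRw (p , p0≡w , steps) = p′ , ≡.refl , steps′
    where
    p′ : ℕ → Fin n
    p′ zero = v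
    p′ (suc i) = p i
    steps′ : ∀ i → i < suc k → R (p′ i) (p′ (suc i))
    steps′ zero _ = ≡.subst (R v) (≡.sym p0≡w) vRw
    steps′ (suc i) (s≤s i<k) = steps i i<k

  walk-segment : ∀ {k} (p : ℕ → Fin n) → (∀ i → i < k → R (p i) (p (suc i)))
               → ∀ i j → i < j → j ≤ k → TransClosure R (p i) (p j)
  walk-segment p steps i (suc j) i<1+j 1+j≤k with m<1+n⇒m<n∨m≡n i<1+j
  ... | inj₁ i<j = walk-segment p steps i j i<j (<⇒≤ 1+j≤k) ∷ʳ steps j 1+j≤k
  ... | inj₂ ≡.refl = [ steps i 1+j≤k ]⁺

  long-walk⇒cycle : ∀ {v} → Walk n v → ∃ λ u → TransClosure R u u
  long-walk⇒cycle (p , _ , steps) with pigeonhole (n<1+n n) (p ∘ toℕ)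
  ... | i , j , i<j , pi≡pj =
    p (toℕ j) , ≡.subst (λ u → TransClosure R u (p (toℕ j))) pi≡pj
                      (walk-segment p steps (toℕ i) (toℕ j) i<j (toℕ≤pred[n] j))

acyclic-induction : ∀ {n r p} (R : Rel (Fin n) r) → Decidable R → (∀ v → ¬ TransClosure R v v)
                  → (P : Pred (Fin n) p) → (∀ v → (∀ w → R v w → P w) → P v) → ∀ v → P v
acyclic-induction {n} R R? acyclic P progressive v =
  [ id , (λ walk → let u , cycle = long-walk⇒cycle walk in ⊥-elim (acyclic u cycle)) ]
    (P-or-walk n v)
  where
  open Walks R

  successor-status : ∀ {k} v → (∀ w → P w ⊎ Walk k w) → ∀ w → (R v w × Walk k w) ⊎ (R v w → P w)
  successor-status v P-or-walkₖ w with R? v w | P-or-walkₖ w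
  ... | no ¬vRw | _ = inj₂ (⊥-elim ∘ ¬vRw)
  ... | yes _ | inj₁ Pw = inj₂ λ _ → Pw
  ... | yes vRw | inj₂ walk = inj₁ (vRw , walk)

  P-or-walk : ∀ k v → P v ⊎ Walk k v
  P-or-walk zero v = inj₂ ((λ _ → v) , ≡.refl , λ _ ())
  P-or-walk (suc k) v with ∀⊎⇒∃⊎∀ (successor-status v (P-or-walk k))
  ... | inj₁ (_ , vRw , walk) = inj₂ (walk-cons vRw walk)
  ... | inj₂ P-successors = inj₁ (progressive v P-successors)

module SemiringLemmas {c ℓ} (K : CommutativeSemiring c ℓ) where
  open CommutativeSemiring K
  open MonoidSum +-monoid using ()
    renaming (sum to Σ⁺; sum-cong-≋ to Σ⁺-cong; sum-replicate-zero to Σ⁺-zeros)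
  open MonoidSum *-monoid using () renaming (sum to Π*)

  Separating : Carrier → Carrier → Set ℓ
  Separating x y = ((x ≈ 0#) ⊎ (y ≈ 0#)) × ¬ (x + y ≈ 0#)

  separating-sym : ∀ {x y} → Separating x y → Separating y x
  separating-sym (x≈0⊎y≈0 , x+y≉0) = [ inj₂ , inj₁ ] x≈0⊎y≈0 , x+y≉0 ∘ trans (+-comm _ _)

  separating-resp-≈ : ∀ {x x′ y y′} → x ≈ x′ → y ≈ y′ → Separating x′ y′ → Separating x y
  separating-resp-≈ x≈x′ y≈y′ (x′≈0⊎y′≈0 , x′+y′≉0) =
    Data.Sum.map (trans x≈x′) (trans y≈y′) x′≈0⊎y′≈0 ,
    x′+y′≉0 ∘ trans (+-cong (sym x≈x′) (sym y≈y′))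

  separating⇒1≉0 : ∀ {x y} → Separating x y → ¬ (1# ≈ 0#)
  separating⇒1≉0 {x} {y} (_ , x+y≉0) 1≈0 = x+y≉0 (≈0 (x + y))
    where
    ≈0 : ∀ z → z ≈ 0#
    ≈0 z = trans (sym (*-identityʳ z)) (trans (*-congˡ 1≈0) (zeroʳ z))

  ≈0⇒Σ⁺≈0 : ∀ {n} (g : Fin n → Carrier) → (∀ i → g i ≈ 0#) → Σ⁺ g ≈ 0#
  ≈0⇒Σ⁺≈0 {n} g g≈0 = trans (Σ⁺-cong g≈0) (Σ⁺-zeros n)

  ∃≈0⇒Π*≈0 : ∀ {n} (g : Fin n → Carrier) → ∃ (λ i → g i ≈ 0#) → Π* g ≈ 0#
  ∃≈0⇒Π*≈0 g (Fin.zero , g0≈0) = trans (*-congʳ g0≈0) (zeroˡ _)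
  ∃≈0⇒Π*≈0 g (Fin.suc i , gi≈0) = trans (*-congˡ (∃≈0⇒Π*≈0 (g ∘ Fin.suc) (i , gi≈0))) (zeroʳ _)

  module Positivity (positive : Positive K) where

    Σ⁺≈0⇒≈0 : ∀ {n} (g : Fin n → Carrier) → Σ⁺ g ≈ 0# → ∀ i → g i ≈ 0#
    Σ⁺≈0⇒≈0 g Σ⁺≈0 Fin.zero = proj₁ (proj₁ positive _ _ Σ⁺≈0)
    Σ⁺≈0⇒≈0 g Σ⁺≈0 (Fin.suc i) = Σ⁺≈0⇒≈0 (g ∘ Fin.suc) (proj₂ (proj₁ positive _ _ Σ⁺≈0)) i

    Π*≈0⇒∃≈0 : ∀ {n} → ¬ (1# ≈ 0#) → (g : Fin n → Carrier) → Π* g ≈ 0# → ∃ λ i → g i ≈ 0#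
    Π*≈0⇒∃≈0 {zero} 1≉0 g 1≈0 = ⊥-elim (1≉0 1≈0)
    Π*≈0⇒∃≈0 {suc n} 1≉0 g Π*≈0 with proj₂ positive _ _ Π*≈0
    ... | inj₁ g0≈0 = Fin.zero , g0≈0
    ... | inj₂ rest≈0 = let i , gi≈0 = Π*≈0⇒∃≈0 1≉0 (g ∘ Fin.suc) rest≈0 in Fin.suc i , gi≈0

    *-cancelˡ-≈0 : ∀ {a x} → ¬ (a ≈ 0#) → a * x ≈ 0# → x ≈ 0#
    *-cancelˡ-≈0 a≉0 ax≈0 = [ ⊥-elim ∘ a≉0 , id ] (proj₂ positive _ _ ax≈0)

    module WeightedSumProduct {n} (e : Fin n → Bool) (ha hb a b : Fin n → Carrier)
      (ha≉0 : ∀ w → e w ≡ true → ¬ (ha w ≈ 0#)) (hb≉0 : ∀ w → e w ≡ true → ¬ (hb w ≈ 0#))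
      (separating : ∀ w → e w ≡ true → Separating (a w) (b w)) where

      sumTerm prodTerm : Fin n → Carrier
      sumTerm w = if e w then ha w * a w else 0#
      prodTerm w = if e w then hb w * b w else 1#

      prodTerm≈0⊎sumTerm≈0 : ∀ w → prodTerm w ≈ 0# ⊎ sumTerm w ≈ 0#
      prodTerm≈0⊎sumTerm≈0 w with e w in ew
      ... | false = inj₂ refl
      ... | true = Data.Sum.map annihilate annihilate (Data.Sum.swap (proj₁ (separating w ew)))
        where
        annihilate : ∀ {h x} → x ≈ 0# → h * x ≈ 0#
        annihilate x≈0 = trans (*-congˡ x≈0) (zeroʳ _)

      sum≈0⊎prod≈0 : Σ⁺ sumTerm ≈ 0# ⊎ Π* prodTerm ≈ 0#
      sum≈0⊎prod≈0 with ∀⊎⇒∃⊎∀ prodTerm≈0⊎sumTerm≈0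
      ... | inj₁ some-prodTerm≈0 = inj₂ (∃≈0⇒Π*≈0 prodTerm some-prodTerm≈0)
      ... | inj₂ all-sumTerm≈0 = inj₁ (≈0⇒Σ⁺≈0 sumTerm all-sumTerm≈0)

      terms-not-both-≈0 : ¬ (1# ≈ 0#) → ∀ w → sumTerm w ≈ 0# → ¬ (prodTerm w ≈ 0#)
      terms-not-both-≈0 1≉0 w with e w in ew
      ... | false = λ _ → 1≉0
      ... | true = λ ha·a≈0 hb·b≈0 → proj₂ (separating w ew)
        (trans (+-cong (*-cancelˡ-≈0 (ha≉0 w ew) ha·a≈0) (*-cancelˡ-≈0 (hb≉0 w ew) hb·b≈0))
               (+-identityˡ 0#))

      sum+prod≉0 : ∃ (λ w → e w ≡ true) → ¬ (Σ⁺ sumTerm + Π* prodTerm ≈ 0#)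
      sum+prod≉0 (w₀ , ew₀) sum+prod≈0 =
        let 1≉0 = separating⇒1≉0 (separating w₀ ew₀)
            sum≈0 , prod≈0 = proj₁ positive _ _ sum+prod≈0
            w , prodTerm-w≈0 = Π*≈0⇒∃≈0 1≉0 prodTerm prod≈0
        in terms-not-both-≈0 1≉0 w (Σ⁺≈0⇒≈0 sumTerm sum≈0 w) prodTerm-w≈0

      sum-prod-separating : ∃ (λ w → e w ≡ true) → Separating (Σ⁺ sumTerm) (Π* prodTerm)
      sum-prod-separating active = sum≈0⊎prod≈0 , sum+prod≉0 active

module Game {c ℓ} (K : CommutativeSemiring c ℓ) (positive : Positive K)
  {n} (G : GameGraph n) (h : Player → Fin n → Fin n → CommutativeSemiring.Carrier K)
  (h≉0 : NonzeroOnEdges K G h) (f : Player → Fin n → CommutativeSemiring.Carrier K)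
  (induced : IsInducedValuation K G h f) where
  open GameGraph G
  open SemiringLemmas K
  open Positivity positive

  owned⇒successor : ∀ {v σ} → kind v ≡ owned σ → ∃ (E v)
  owned⇒successor {v} kind≡owned =
    let w , ¬edge≡false = ¬∀⟶∃¬ _ (λ w → edge v w ≡ false) (λ w → edge v w ≟ false)
                                (owned≢terminal ∘ noSucc-iff-terminal v)
    in w , ¬-not ¬edge≡false
    where
    owned≢terminal : ¬ (kind v ≡ terminal)
    owned≢terminal kind≡terminal with ≡.trans (≡.sym kind≡owned) kind≡terminal
    ... | ()

  separating-at-owned : ∀ {v σ} → kind v ≡ owned σ → (∀ w → E v w → StronglySeparatingAt K f w)
                      → StronglySeparatingAt K f v
  separating-at-owned {v} {P0} kind≡owned separating =
    separating-resp-≈ (proj₁ (induced P0 v) kind≡owned) (proj₂ (induced P1 v) kind≡owned)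
      (WeightedSumProduct.sum-prod-separating (edge v) (h P0 v) (h P1 v) (f P0) (f P1)
        (h≉0 P0 v) (h≉0 P1 v) separating (owned⇒successor kind≡owned))
  separating-at-owned {v} {P1} kind≡owned separating =
    separating-sym
      (separating-resp-≈ (proj₁ (induced P1 v) kind≡owned) (proj₂ (induced P0 v) kind≡owned)
      (WeightedSumProduct.sum-prod-separating (edge v) (h P1 v) (h P0 v) (f P1) (f P0)
        (h≉0 P1 v) (h≉0 P0 v) (λ w → separating-sym ∘ separating w) (owned⇒successor kind≡owned)))

mainTheorem7 : {c ℓ : Level} (K : CommutativeSemiring c ℓ) → Positive K
  → {n : ℕ} (G : GameGraph n) → Acyclic G
  → (h : Player → Fin n → Fin n → CommutativeSemiring.Carrier K)
  → NonzeroOnEdges K G h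
  → (f : Player → Fin n → CommutativeSemiring.Carrier K)
  → IsInducedValuation K G h f
  → (∀ t → GameGraph.kind G t ≡ terminal → StronglySeparatingAt K f t)
  → ∀ v → StronglySeparatingAt K f v
mainTheorem7 K positive G acyclic h h≉0 f induced terminal-separating =
  acyclic-induction E (λ v w → edge v w ≟ true) acyclic (StronglySeparatingAt K f) progressive
  where
  open GameGraph G
  open Game K positive G h h≉0 f induced

  progressive : ∀ v → (∀ w → E v w → StronglySeparatingAt K f w) → StronglySeparatingAt K f v
  progressive v separating with kind v in kind≡
  ... | terminal = terminal-separating v kind≡
  ... | owned σ = separating-at-owned kind≡ separating
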